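{- Let $r$, $m$, $n$ be positive integers with $m,n\ge 3$, let $G=K_m[P_n]$, and let $\delta$ and $\Delta$ denote the minimum and maximum degree of $G$. Then: (i) $\chi_r(G)\ge 2m$ for $1\le r\le 2m-1$; (ii) $\chi_r(G)\ge r+2+\left\lfloor \frac{r-2m}{m-1}\right\rfloor$ for $2m\le r\le \delta$; (iii) $\chi_r(G)\ge mn$ for $r\ge \Delta$.
   Context: All graphs are finite, simple, undirected. An $r$-dynamic $k$-coloring of a graph $G$ is a map $c:V(G)\to\{1,\dots,k\}$ such that $c(u)\neq c(v)$ for every edge $uv$, and for every vertex $v$, $|c(N(v))|\ge \min\{r,d(v)\}$, where $N(v)$ is the set of neighbours of $v$ and $d(v)$ its degree. The $r$-dynamic chromatic number $\chi_r(G)$ is the least $k$ for which an $r$-dynamic $k$-coloring exists. $K_m$ is the complete graph on $m$ vertices and $P_n$ the path on $n$ vertices. The lexicographic product $G_1[G_2]$ has vertex set $V(G_1)\times V(G_2)$, with $(g,h)$ adjacent to $(g',h')$ iff $gg'\in E(G_1)$, or $g=g'$ and $hh'\in E(G_2)$. -}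

module Defs where

open import Data.Nat using (ℕ; zero; suc; _*_; _≤_; _⊓_; _≡ᵇ_)
open import Data.Nat.DivMod using (_/_)
open import Data.Bool using (Bool; true; false; _∧_; _∨_; not)
open import Data.Fin using (Fin; toℕ; _≟_; remQuot)
open import Data.Fin.Subset using (Subset; ∣_∣)
open import Data.Vec using (tabulate)
open import Data.Product using (Σ; _×_; _,_; proj₁; proj₂)
open import Relation.Nullary using (¬_)
open import Relation.Nullary.Decidable using (⌊_⌋)
open import Relation.Binary.PropositionalEquality using (_≡_; _≢_)

-- A finite graph on the vertex set Fin N, given by a Boolean adjacency relation.
-- (All concrete graphs below are simple: irreflexive and symmetric.)
record Graph (N : ℕ) : Set where
  field
    adj : Fin N → Fin N → Bool
open Graph public

anyFin : ∀ {N} → (Fin N → Bool) → Bool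
anyFin {zero}  p = false
anyFin {suc N} p = p Fin.zero ∨ anyFin (λ i → p (Fin.suc i))

nbhd : ∀ {N} → Graph N → Fin N → Subset N
nbhd G v = tabulate (adj G v)

deg : ∀ {N} → Graph N → Fin N → ℕ
deg G v = ∣ nbhd G v ∣

IsMinDegree : ∀ {N} → Graph N → ℕ → Set
IsMinDegree G δ = Σ _ (λ v → deg G v ≡ δ) × (∀ v → δ ≤ deg G v)

IsMaxDegree : ∀ {N} → Graph N → ℕ → Set
IsMaxDegree G Δ = Σ _ (λ v → deg G v ≡ Δ) × (∀ v → deg G v ≤ Δ)

colorsAt : ∀ {N k} → Graph N → (Fin N → Fin k) → Fin N → Subset k
colorsAt G c v = tabulate (λ j → anyFin (λ u → adj G v u ∧ ⌊ c u ≟ j ⌋))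

IsRDynamicColoring : ∀ {N} → Graph N → (r k : ℕ) → (Fin N → Fin k) → Set
IsRDynamicColoring G r k c =
  (∀ u v → adj G u v ≡ true → c u ≢ c v) ×
  (∀ v → r ⊓ deg G v ≤ ∣ colorsAt G c v ∣)

HasRDynamicColoring : ∀ {N} → Graph N → (r k : ℕ) → Set
HasRDynamicColoring {N} G r k = Σ (Fin N → Fin k) (IsRDynamicColoring G r k)

χ≥ : ∀ {N} → Graph N → (r b : ℕ) → Set
χ≥ G r b = ∀ k → HasRDynamicColoring G r k → b ≤ k

K : (m : ℕ) → Graph m
adj (K m) i j = not ⌊ i ≟ j ⌋

P : (n : ℕ) → Graph n
adj (P n) i j = (toℕ i ≡ᵇ suc (toℕ j)) ∨ (toℕ j ≡ᵇ suc (toℕ i))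

-- lexicographic product G[H], vertex (g,h) encoded in Fin (m * n) via remQuot
Lex : ∀ {m n} → Graph m → Graph n → Graph (m * n)
adj (Lex {m} {n} G H) x y with remQuot n x | remQuot n y
... | (g , h) | (g' , h') = adj G g g' ∨ (⌊ g ≟ g' ⌋ ∧ adj H h h')

-- floor division, ⌊a / b⌋ (b = 0 never occurs in use)
floorDiv : ℕ → ℕ → ℕ
floorDiv a zero    = 0
floorDiv a (suc b) = a / suc b

-- (i) K_m[P_n] contains the clique K_m[K_2] on 2m vertices.
-- (ii) Let W_g be the set of colours used outside the copy g of P_n. The end vertex (g,0) sees
-- all of W_g and one more colour, so |W_g| ≥ r − 1. Different copies are completely joined, so
-- each colour lives in a single copy and is missing from some W_g. Double counting gives
-- m(r − 1) ≤ k(m − 1), which rearranges to the stated bound.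
-- (iii) If r ≥ Δ, an r-dynamic colouring is injective on every neighbourhood; any two vertices
-- are adjacent or have a common neighbour in another copy of P_n, so the colouring is injective.

module Submission where

open import Defs
open import Data.Bool using (Bool; true; false; _∧_; _∨_; not)
open import Data.Bool.Properties using (∨-zeroʳ)
open import Data.Empty using (⊥-elim)
open import Data.Fin using (Fin; zero; suc; _≟_; remQuot; combine; punchIn)
open import Data.Fin.Properties using (remQuot-combine; combine-remQuot; injective⇒≤; punchInᵢ≢i; suc-injective)
open import Data.Nat using (ℕ; zero; suc; _≤_; _<_; _+_; _*_; _∸_; _⊓_; z≤n; s≤s)
open import Data.Nat.Properties
  using (module ≤-Reasoning; ≤-refl; ≤-trans; ≤-reflexive; <-≤-trans; ≤-<-trans; ≤-pred; <⇒≱; ≮⇒≥; n<1+n;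
         +-mono-≤; +-monoʳ-≤; +-mono-<-≤; +-mono-≤-<; +-suc; *-monoˡ-≤; *-distribʳ-+; *-comm; *-identityʳ; *-zeroʳ;
         ∸-monoˡ-≤; m+n∸n≡m; m+[n∸m]≡n; m≤n⇒m⊓n≡m; m≥n⇒m⊓n≡n; +-0-commutativeMonoid)
open import Data.Nat.DivMod using (_/_; m/n*n≤m)
open import Data.Nat.Tactic.RingSolver using (solve-∀)
open import Data.Product using (∃; _×_; _,_; proj₁; proj₂)
open import Data.Sum using (_⊎_; inj₁; inj₂)
open import Data.Fin.Subset using (∣_∣)
open import Data.Vec using (tabulate)
open import Function using (_∘_; id)
open import Relation.Nullary using (Dec; yes; no)
open import Relation.Nullary.Decidable using (⌊_⌋; ⌊⌋-map′)
open import Relation.Binary.PropositionalEquality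
  using (_≡_; _≢_; refl; sym; trans; cong; cong₂; subst; subst₂; module ≡-Reasoning)

open import Algebra.Properties.CommutativeMonoid.Sum +-0-commutativeMonoid
  using (sum; sum-syntax; sum-cong-≗; ∑-distrib-+; ∑-comm)

∧-true : ∀ {a b} → a ∧ b ≡ true → a ≡ true × b ≡ true
∧-true {true} {true} _ = refl , refl

∨-true : ∀ {a b} → a ∨ b ≡ true → a ≡ true ⊎ b ≡ true
∨-true {true}  _  = inj₁ refl
∨-true {false} eq = inj₂ eq

≟-true⇒≡ : ∀ {n} {x y : Fin n} → ⌊ x ≟ y ⌋ ≡ true → x ≡ y
≟-true⇒≡ {x = x} {y} eq with x ≟ y
... | yes x≡y = x≡y

≡⇒≟-true : ∀ {n} {x y : Fin n} → x ≡ y → ⌊ x ≟ y ⌋ ≡ true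
≡⇒≟-true {x = x} {y} x≡y with x ≟ y
... | yes _   = refl
... | no  x≢y = ⊥-elim (x≢y x≡y)

≢⇒not-≟-true : ∀ {n} {x y : Fin n} → x ≢ y → not ⌊ x ≟ y ⌋ ≡ true
≢⇒not-≟-true {x = x} {y} x≢y with x ≟ y
... | yes x≡y = ⊥-elim (x≢y x≡y)
... | no  _   = refl

not-≟-true⇒≢ : ∀ {n} {x y : Fin n} → not ⌊ x ≟ y ⌋ ≡ true → x ≢ y
not-≟-true⇒≢ {x = x} {y} eq with x ≟ y
... | no x≢y = x≢y

indicator : Bool → ℕ
indicator true  = 1
indicator false = 0

count : ∀ {n} → (Fin n → Bool) → ℕ
count {n} p = ∑[ i < n ] indicator (p i)

∑-mono-≤ : ∀ {n} {f g : Fin n → ℕ} → (∀ i → f i ≤ g i) → sum f ≤ sum g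
∑-mono-≤ {zero}  f≤g = z≤n
∑-mono-≤ {suc n} f≤g = +-mono-≤ (f≤g zero) (∑-mono-≤ (f≤g ∘ suc))

∑-mono-< : ∀ {n} {f g : Fin n → ℕ} → (∀ i → f i ≤ g i) → ∀ i → f i < g i → sum f < sum g
∑-mono-< f≤g zero    fi<gi = +-mono-<-≤ fi<gi (∑-mono-≤ (f≤g ∘ suc))
∑-mono-< f≤g (suc i) fi<gi = +-mono-≤-< (f≤g zero) (∑-mono-< (f≤g ∘ suc) i fi<gi)

∑-const : ∀ n (x : ℕ) → ∑[ i < n ] x ≡ n * x
∑-const zero    x = refl
∑-const (suc n) x = cong (x +_) (∑-const n x)

_⊆ᵇ_ : ∀ {n} → (Fin n → Bool) → (Fin n → Bool) → Set
p ⊆ᵇ q = ∀ i → p i ≡ true → q i ≡ true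

indicator-mono : ∀ {a b} → (a ≡ true → b ≡ true) → indicator a ≤ indicator b
indicator-mono {false} a⇒b = z≤n
indicator-mono {true}  a⇒b rewrite a⇒b refl = ≤-refl

indicator-∨ : ∀ a b → indicator (a ∨ b) ≤ indicator a + indicator b
indicator-∨ false b     = ≤-refl
indicator-∨ true  false = ≤-refl
indicator-∨ true  true  = s≤s z≤n

count-mono : ∀ {n} {p q : Fin n → Bool} → p ⊆ᵇ q → count p ≤ count q
count-mono p⊆q = ∑-mono-≤ (λ i → indicator-mono (p⊆q i))

count-mono-< : ∀ {n} {p q : Fin n → Bool} → p ⊆ᵇ q → ∀ i → p i ≡ false → q i ≡ true → count p < count q
count-mono-< {p = p} {q} p⊆q i pi qi = ∑-mono-< (λ j → indicator-mono (p⊆q j)) i indicator-<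
  where
  indicator-< : indicator (p i) < indicator (q i)
  indicator-< rewrite pi | qi = s≤s z≤n

count-∨ : ∀ {n} (p q : Fin n → Bool) → count (λ i → p i ∨ q i) ≤ count p + count q
count-∨ p q = ≤-trans (∑-mono-≤ (λ i → indicator-∨ (p i) (q i)))
                      (≤-reflexive (∑-distrib-+ (indicator ∘ p) (indicator ∘ q)))

count-const : ∀ n (b : Bool) → count {n} (λ _ → b) ≡ n * indicator b
count-const n b = ∑-const n (indicator b)

count-≟ : ∀ {n} (a : Fin n) → count (λ j → ⌊ a ≟ j ⌋) ≡ 1
count-≟ {suc n} zero    = cong suc (trans (count-const n false) (*-zeroʳ n))
count-≟ {suc n} (suc a) =
  trans (sum-cong-≗ (λ j → cong indicator (⌊⌋-map′ (cong suc) suc-injective (a ≟ j)))) (count-≟ a)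

count<n : ∀ {n} (p : Fin n → Bool) i → p i ≡ false → count p < n
count<n {n} p i pi =
  <-≤-trans (count-mono-< (λ _ _ → refl) i pi refl) (≤-reflexive (trans (count-const n true) (*-identityʳ n)))

∣tabulate∣≡count : ∀ {n} (p : Fin n → Bool) → ∣ tabulate p ∣ ≡ count p
∣tabulate∣≡count {zero}  p = refl
∣tabulate∣≡count {suc n} p with p zero
... | true  = cong suc (∣tabulate∣≡count (p ∘ suc))
... | false = ∣tabulate∣≡count (p ∘ suc)

anyFin-intro : ∀ {n} (p : Fin n → Bool) i → p i ≡ true → anyFin p ≡ true
anyFin-intro p zero    pi rewrite pi = refl
anyFin-intro p (suc i) pi with p zero
... | true  = refl
... | false = anyFin-intro (p ∘ suc) i pi

anyFin-elim : ∀ {n} (p : Fin n → Bool) → anyFin p ≡ true → ∃ λ i → p i ≡ true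
anyFin-elim {suc n} p eq with p zero in p0
... | true  = zero , p0
... | false with anyFin-elim (p ∘ suc) eq
...   | i , pi = suc i , pi

-- colorsAt G c v is definitionally tabulate (image (adj G v) c).
image : ∀ {n k} → (Fin n → Bool) → (Fin n → Fin k) → Fin k → Bool
image p c j = anyFin (λ u → p u ∧ ⌊ c u ≟ j ⌋)

image-intro : ∀ {n k} (p : Fin n → Bool) (c : Fin n → Fin k) {u j} → p u ≡ true → c u ≡ j → image p c j ≡ true
image-intro p c {u} pu cu≡j = anyFin-intro _ u (cong₂ _∧_ pu (≡⇒≟-true cu≡j))

image-elim : ∀ {n k} (p : Fin n → Bool) (c : Fin n → Fin k) {j} →
             image p c j ≡ true → ∃ λ u → p u ≡ true × c u ≡ j
image-elim p c eq with anyFin-elim _ eq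
... | u , pu∧cu with ∧-true pu∧cu
...   | pu , cu = u , pu , ≟-true⇒≡ cu

count-image : ∀ {n k} (p : Fin n → Bool) (c : Fin n → Fin k) → count (image p c) ≤ count p
count-image {zero}  {k} p c = ≤-reflexive (trans (count-const k false) (*-zeroʳ k))
count-image {suc n} {k} p c = begin
  count (image p c)
    ≤⟨ count-∨ _ (image (p ∘ suc) (c ∘ suc)) ⟩
  count (λ j → p zero ∧ ⌊ c zero ≟ j ⌋) + count (image (p ∘ suc) (c ∘ suc))
    ≤⟨ +-mono-≤ first (count-image (p ∘ suc) (c ∘ suc)) ⟩
  indicator (p zero) + count (p ∘ suc)
    ∎
  where
  open ≤-Reasoning
  first : count (λ j → p zero ∧ ⌊ c zero ≟ j ⌋) ≤ indicator (p zero)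
  first with p zero
  ... | true  = ≤-reflexive (count-≟ (c zero))
  ... | false = ≤-reflexive (trans (count-const k false) (*-zeroʳ k))

count-image-collision : ∀ {n k} (p : Fin n → Bool) (c : Fin n → Fin k) {x y} →
  p x ≡ true → p y ≡ true → x ≢ y → c x ≡ c y → count (image p c) < count p
count-image-collision {n} p c {x} {y} px py x≢y cx≡cy =
  ≤-<-trans (count-mono image⊆) (≤-<-trans (count-image p′ c) (count-mono-< (λ u → proj₁ ∘ ∧-true) y p′y py))
  where
  -- Removing y from p keeps the image, because x has the colour of y.
  p′ : Fin n → Bool
  p′ u = p u ∧ not ⌊ u ≟ y ⌋
  p′y : p′ y ≡ false
  p′y rewrite ≡⇒≟-true (refl {x = y}) with p y
  ... | true  = refl
  ... | false = refl
  image⊆ : image p c ⊆ᵇ image p′ c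
  image⊆ j eq with image-elim p c eq
  ... | u , pu , cu≡j with u ≟ y
  ...   | no  u≢y = image-intro p′ c (cong₂ _∧_ pu (≢⇒not-≟-true u≢y)) cu≡j
  ...   | yes refl = image-intro p′ c (cong₂ _∧_ px (≢⇒not-≟-true x≢y)) (trans cx≡cy cu≡j)

count-image-insert : ∀ {n k} (p q : Fin n → Bool) (c : Fin n → Fin k) y →
  (∀ x → q x ≡ true → p x ≡ true ⊎ x ≡ y) → count (image q c) ≤ count (image p c) + 1
count-image-insert p q c y q⊆p∪y = begin
  count (image q c)                                ≤⟨ count-mono image⊆ ⟩
  count (λ j → image p c j ∨ ⌊ c y ≟ j ⌋)          ≤⟨ count-∨ (image p c) _ ⟩
  count (image p c) + count (λ j → ⌊ c y ≟ j ⌋)    ≡⟨ cong (count (image p c) +_) (count-≟ (c y)) ⟩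
  count (image p c) + 1                            ∎
  where
  open ≤-Reasoning
  image⊆ : image q c ⊆ᵇ (λ j → image p c j ∨ ⌊ c y ≟ j ⌋)
  image⊆ j eq with image-elim q c eq
  ... | x , qx , cx≡j with q⊆p∪y x qx
  ...   | inj₁ px   = cong (_∨ ⌊ c y ≟ j ⌋) (image-intro p c px cx≡j)
  ...   | inj₂ refl = trans (cong (image p c j ∨_) (≡⇒≟-true cx≡j)) (∨-zeroʳ (image p c j))

module _ {N} (G : Graph N) {r k} {c : Fin N → Fin k} (dynamic : IsRDynamicColoring G r k c) where

  colours-around : ∀ v → r ⊓ count (adj G v) ≤ count (image (adj G v) c)
  colours-around v =
    subst₂ _≤_ (cong (r ⊓_) (∣tabulate∣≡count (adj G v))) (∣tabulate∣≡count (image (adj G v) c)) (proj₂ dynamic v)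

  colours-around-≥ : ∀ v → r ≤ deg G v → r ≤ count (image (adj G v) c)
  colours-around-≥ v r≤deg = subst (_≤ _) (m≤n⇒m⊓n≡m (subst (r ≤_) (∣tabulate∣≡count (adj G v)) r≤deg)) (colours-around v)

  injective-around : ∀ v → deg G v ≤ r → ∀ {x y} → adj G v x ≡ true → adj G v y ≡ true → c x ≡ c y → x ≡ y
  injective-around v deg≤r {x} {y} vx vy cx≡cy with x ≟ y
  ... | yes x≡y = x≡y
  ... | no  x≢y = ⊥-elim (<⇒≱ (count-image-collision (adj G v) c vx vy x≢y cx≡cy) all-colours)
    where
    all-colours : count (adj G v) ≤ count (image (adj G v) c)
    all-colours = subst (_≤ _) (m≥n⇒m⊓n≡n (subst (_≤ r) (∣tabulate∣≡count (adj G v)) deg≤r)) (colours-around v)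

IsClique : ∀ {N b} → Graph N → (Fin b → Fin N) → Set
IsClique G e = ∀ i j → i ≢ j → adj G (e i) (e j) ≡ true

clique⇒χ≥ : ∀ {N b} (G : Graph N) (e : Fin b → Fin N) → IsClique G e → ∀ r → χ≥ G r b
clique⇒χ≥ G e clique r k (c , proper , _) = injective⇒≤ c∘e-injective
  where
  c∘e-injective : ∀ {i j} → c (e i) ≡ c (e j) → i ≡ j
  c∘e-injective {i} {j} eq with i ≟ j
  ... | yes i≡j = i≡j
  ... | no  i≢j = ⊥-elim (proper (e i) (e j) (clique i j i≢j) eq)

AdjacentOrCommonNeighbour : ∀ {N} → Graph N → Fin N → Fin N → Set
AdjacentOrCommonNeighbour G x y = adj G x y ≡ true ⊎ ∃ λ w → adj G w x ≡ true × adj G w y ≡ true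

DiameterAtMostTwo : ∀ {N} → Graph N → Set
DiameterAtMostTwo G = ∀ x y → x ≢ y → AdjacentOrCommonNeighbour G x y

diameter≤2⇒χ≥ : ∀ {N} (G : Graph N) → DiameterAtMostTwo G → ∀ r → (∀ v → deg G v ≤ r) → χ≥ G r N
diameter≤2⇒χ≥ G close r deg≤r k (c , dynamic) = injective⇒≤ c-injective
  where
  c-injective : ∀ {x y} → c x ≡ c y → x ≡ y
  c-injective {x} {y} cx≡cy with x ≟ y
  ... | yes x≡y = x≡y
  ... | no  x≢y with close x y x≢y
  ...   | inj₁ xy           = ⊥-elim (proj₁ dynamic x y xy cx≡cy)
  ...   | inj₂ (w , wx , wy) = injective-around G dynamic w (deg≤r w) wx wy cx≡cy

module LexVertex (m n : ℕ) where

  block : Fin (m * n) → Fin m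
  block x = proj₁ (remQuot {m} n x)

  layer : Fin (m * n) → Fin n
  layer x = proj₂ (remQuot {m} n x)

  combine-block-layer : ∀ x → combine (block x) (layer x) ≡ x
  combine-block-layer = combine-remQuot {m} n

  block-combine : ∀ g h → block (combine g h) ≡ g
  block-combine g h = cong proj₁ (remQuot-combine {m} g h)

  layer-combine : ∀ g h → layer (combine g h) ≡ h
  layer-combine g h = cong proj₂ (remQuot-combine {m} g h)

combine-map : ∀ {a b m n} → (Fin a → Fin m) → (Fin b → Fin n) → Fin (a * b) → Fin (m * n)
combine-map {a} {b} e₁ e₂ i = combine (e₁ (LexVertex.block a b i)) (e₂ (LexVertex.layer a b i))

module _ {m n : ℕ} (G : Graph m) (H : Graph n) where
  open LexVertex m n

  adj-Lex : ∀ x y → adj (Lex G H) x y ≡ adj G (block x) (block y) ∨ (⌊ block x ≟ block y ⌋ ∧ adj H (layer x) (layer y))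
  adj-Lex x y with remQuot {m} n x | remQuot {m} n y
  ... | _ | _ = refl

  adj-Lex-combine : ∀ g h g′ h′ → adj (Lex G H) (combine g h) (combine g′ h′) ≡ adj G g g′ ∨ (⌊ g ≟ g′ ⌋ ∧ adj H h h′)
  adj-Lex-combine g h g′ h′ =
    trans (adj-Lex (combine g h) (combine g′ h′))
          (cong₂ (λ a b → adj G (proj₁ a) (proj₁ b) ∨ (⌊ proj₁ a ≟ proj₁ b ⌋ ∧ adj H (proj₂ a) (proj₂ b)))
                 (remQuot-combine {m} g h) (remQuot-combine {m} g′ h′))

  Lex-clique : ∀ {a b} (e₁ : Fin a → Fin m) (e₂ : Fin b → Fin n) → IsClique G e₁ → IsClique H e₂ →
               IsClique (Lex G H) (combine-map e₁ e₂)
  Lex-clique {a} {b} e₁ e₂ clique₁ clique₂ i j i≢j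
    rewrite adj-Lex-combine (e₁ (LexVertex.block a b i)) (e₂ (LexVertex.layer a b i))
                            (e₁ (LexVertex.block a b j)) (e₂ (LexVertex.layer a b j))
    with LexVertex.block a b i ≟ LexVertex.block a b j
  ... | no  bi≢bj = cong (_∨ _) (clique₁ _ _ bi≢bj)
  ... | yes bi≡bj =
    trans (cong₂ (λ u v → adj G (e₁ (block′ i)) (e₁ (block′ j)) ∨ (u ∧ v)) (≡⇒≟-true (cong e₁ bi≡bj)) (clique₂ _ _ li≢lj))
          (∨-zeroʳ _)
    where
    open LexVertex a b using () renaming (block to block′; layer to layer′; combine-block-layer to split)
    li≢lj : layer′ i ≢ layer′ j
    li≢lj li≡lj = i≢j (trans (sym (split i)) (trans (cong₂ combine bi≡bj li≡lj) (split j)))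

K-clique : ∀ m → IsClique (K m) id
K-clique m i j i≢j = ≢⇒not-≟-true i≢j

first-edge : ∀ {n} → Fin 2 → Fin (suc (suc n))
first-edge zero    = zero
first-edge (suc _) = suc zero

P-first-edge-clique : ∀ n → IsClique (P (suc (suc n))) first-edge
P-first-edge-clique n zero    zero          0≢0 = ⊥-elim (0≢0 refl)
P-first-edge-clique n zero    (suc zero)    _   = refl
P-first-edge-clique n (suc zero) zero       _   = refl
P-first-edge-clique n (suc zero) (suc zero) 1≢1 = ⊥-elim (1≢1 refl)

P-zero-neighbour : ∀ {n} (h : Fin (suc (suc n))) → adj (P (suc (suc n))) zero h ≡ true → h ≡ suc zero
P-zero-neighbour (suc zero) _ = refl
P-zero-neighbour (suc (suc h)) ()

module _ {m n : ℕ} (H : Graph n) where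
  open LexVertex m n

  Lex-K-adj : ∀ x y → block x ≢ block y → adj (Lex (K m) H) x y ≡ true
  Lex-K-adj x y bx≢by =
    trans (adj-Lex (K m) H x y) (cong (_∨ (⌊ block x ≟ block y ⌋ ∧ adj H (layer x) (layer y))) (≢⇒not-≟-true bx≢by))

  Lex-K-adj-same-block : ∀ x y → adj (Lex (K m) H) x y ≡ true → block x ≡ block y → adj H (layer x) (layer y) ≡ true
  Lex-K-adj-same-block x y xy bx≡by with ∨-true (trans (sym (adj-Lex (K m) H x y)) xy)
  ... | inj₁ bx≢by = ⊥-elim (not-≟-true⇒≢ bx≢by bx≡by)
  ... | inj₂ same  = proj₂ (∧-true same)

module _ {m n : ℕ} (H : Graph n) where
  open LexVertex (suc (suc m)) n

  Lex-K-diameter≤2 : DiameterAtMostTwo (Lex (K (suc (suc m))) H)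
  Lex-K-diameter≤2 x y x≢y = by-block (block x ≟ block y)
    where
    adjacent : ∀ u v → block u ≢ block v → adj (Lex (K (suc (suc m))) H) u v ≡ true
    adjacent = Lex-K-adj {suc (suc m)} H
    w : Fin (suc (suc m) * n)
    w = combine (punchIn (block x) zero) (layer x)
    bw≢bx : block w ≢ block x
    bw≢bx bw≡bx = punchInᵢ≢i (block x) zero (trans (sym (block-combine _ _)) bw≡bx)
    by-block : Dec (block x ≡ block y) → AdjacentOrCommonNeighbour (Lex (K (suc (suc m))) H) x y
    by-block (no  bx≢by) = inj₁ (adjacent x y bx≢by)
    by-block (yes bx≡by) = inj₂ (w , adjacent w x bw≢bx , adjacent w y (λ bw≡by → bw≢bx (trans bw≡by (sym bx≡by))))

module _ {d n : ℕ} (H : Graph n) (h₀ h₁ : Fin n) (h₀-leaf : ∀ h → adj H h₀ h ≡ true → h ≡ h₁) where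
  open LexVertex (suc d) n

  usedOutside : ∀ {k} → (Fin (suc d * n) → Fin k) → Fin (suc d) → Fin k → Bool
  usedOutside c g = image (λ x → not ⌊ g ≟ block x ⌋) c

  module _ {r k} {c : Fin (suc d * n) → Fin k} (dynamic : IsRDynamicColoring (Lex (K (suc d)) H) r k c) where

    leaf-neighbour : ∀ g x → adj (Lex (K (suc d)) H) (combine g h₀) x ≡ true →
                     not ⌊ g ≟ block x ⌋ ≡ true ⊎ x ≡ combine g h₁
    leaf-neighbour g x vx with g ≟ block x
    ... | no  _    = inj₁ refl
    ... | yes refl = inj₂ (begin
      x                              ≡⟨ sym (combine-block-layer x) ⟩
      combine (block x) (layer x)    ≡⟨ cong (combine (block x)) (h₀-leaf (layer x) h₀x) ⟩
      combine (block x) h₁           ∎)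
      where
      open ≡-Reasoning
      h₀x : adj H h₀ (layer x) ≡ true
      h₀x = subst (λ h → adj H h (layer x) ≡ true) (layer-combine (block x) h₀)
                  (Lex-K-adj-same-block H (combine (block x) h₀) x vx (block-combine (block x) h₀))

    colours-outside : ∀ g → r ≤ deg (Lex (K (suc d)) H) (combine g h₀) → r ∸ 1 ≤ count (usedOutside c g)
    colours-outside g r≤deg = begin
      r ∸ 1                                    ≤⟨ ∸-monoˡ-≤ 1 (≤-trans (colours-around-≥ _ dynamic v r≤deg) insert) ⟩
      count (usedOutside c g) + 1 ∸ 1           ≡⟨ m+n∸n≡m (count (usedOutside c g)) 1 ⟩
      count (usedOutside c g)                  ∎
      where
      open ≤-Reasoning
      v : Fin (suc d * n)
      v = combine g h₀
      insert : count (image (adj (Lex (K (suc d)) H) v) c) ≤ count (usedOutside c g) + 1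
      insert = count-image-insert _ (adj (Lex (K (suc d)) H) v) c (combine g h₁) (leaf-neighbour g)

    colour-class-in-one-block : ∀ {y z} → c y ≡ c z → block y ≡ block z
    colour-class-in-one-block {y} {z} cy≡cz with block y ≟ block z
    ... | yes by≡bz = by≡bz
    ... | no  by≢bz = ⊥-elim (proj₁ dynamic y z (Lex-K-adj H y z by≢bz) cy≡cz)

    unused-outside-own-block : ∀ {y j} → c y ≡ j → usedOutside c (block y) j ≡ false
    unused-outside-own-block {y} {j} cy≡j with usedOutside c (block y) j in used
    ... | false = refl
    ... | true with image-elim _ c used
    ...   | z , by≢bz , cz≡j =
      ⊥-elim (not-≟-true⇒≢ by≢bz (colour-class-in-one-block (trans cy≡j (sym cz≡j))))

    colour-missing-somewhere : ∀ j → ∃ λ g → usedOutside c g j ≡ false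
    colour-missing-somewhere j with usedOutside c zero j in used
    ... | false = zero , used
    ... | true with image-elim _ c used
    ...   | y , _ , cy≡j = block y , unused-outside-own-block cy≡j

    colour-count-bound : (∀ g → r ≤ deg (Lex (K (suc d)) H) (combine g h₀)) → suc d * (r ∸ 1) ≤ k * d
    colour-count-bound r≤deg = begin
      suc d * (r ∸ 1)                                   ≡⟨ ∑-const (suc d) (r ∸ 1) ⟨
      ∑[ g < suc d ] (r ∸ 1)                            ≤⟨ ∑-mono-≤ (λ g → colours-outside g (r≤deg g)) ⟩
      ∑[ g < suc d ] count (usedOutside c g)            ≡⟨ ∑-comm (λ g j → indicator (usedOutside c g j)) ⟩
      ∑[ j < k ] count (λ g → usedOutside c g j)        ≤⟨ ∑-mono-≤ missing ⟩
      ∑[ j < k ] d                                      ≡⟨ ∑-const k d ⟩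
      k * d                                             ∎
      where
      open ≤-Reasoning
      missing : ∀ j → count (λ g → usedOutside c g j) ≤ d
      missing j = let g , unused = colour-missing-somewhere j in ≤-pred (count<n (λ g → usedOutside c g j) g unused)

-- With D = m − 1 and r = 2m + s we have m(r − 1) = (r + 1)D + s + 1, whereas k ≤ r + 1 + ⌊s/D⌋
-- would give kD ≤ (r + 1)D + s.
floorDiv-bound : ∀ e r k → 2 * suc (suc e) ≤ r → suc (suc e) * (r ∸ 1) ≤ k * suc e →
                 r + 2 + floorDiv (r ∸ 2 * suc (suc e)) (suc (suc e) ∸ 1) ≤ k
floorDiv-bound e r k 2m≤r count-bound with r ∸ 2 * suc (suc e) | m+[n∸m]≡n 2m≤r
... | s | refl = ≮⇒≥ λ k<bound → <⇒≱ (kD<count k<bound) count-bound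
  where
  D X : ℕ
  D = suc e
  X = (2 * suc D + s + 1) * D + s
  expand : ∀ a b → suc a * (a + (suc a + 0) + b) ≡ suc ((2 * suc a + b + 1) * a + b)
  expand = solve-∀
  kD<count : k < 2 * suc D + s + 2 + s / D → k * D < suc D * (2 * suc D + s ∸ 1)
  kD<count k<bound = begin-strict
    k * D                                ≤⟨ *-monoˡ-≤ D (≤-pred (subst (λ b → k < b + s / D) (+-suc (2 * suc D + s) 1) k<bound)) ⟩
    (2 * suc D + s + 1 + s / D) * D      ≡⟨ *-distribʳ-+ D (2 * suc D + s + 1) (s / D) ⟩
    (2 * suc D + s + 1) * D + s / D * D  ≤⟨ +-monoʳ-≤ ((2 * suc D + s + 1) * D) (m/n*n≤m s D) ⟩
    X                                    <⟨ n<1+n X ⟩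
    suc X                                ≡⟨ expand D s ⟨
    suc D * (2 * suc D + s ∸ 1)          ∎
    where open ≤-Reasoning

lemma5 : (r m n : ℕ) → 1 ≤ r → 3 ≤ m → 3 ≤ n →
    ((r ≤ 2 * m ∸ 1 → χ≥ (Lex (K m) (P n)) r (2 * m))
    × (∀ δ → IsMinDegree (Lex (K m) (P n)) δ → 2 * m ≤ r → r ≤ δ →
         χ≥ (Lex (K m) (P n)) r (r + 2 + floorDiv (r ∸ 2 * m) (m ∸ 1)))
    × (∀ Δ → IsMaxDegree (Lex (K m) (P n)) Δ → Δ ≤ r →
         χ≥ (Lex (K m) (P n)) r (m * n)))
lemma5 r m@(suc (suc (suc a))) n@(suc (suc n′)) _ (s≤s (s≤s (s≤s _))) (s≤s (s≤s (s≤s _))) =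
  part-i , part-ii , part-iii
  where
  G : Graph (m * n)
  G = Lex (K m) (P n)

  part-i : r ≤ 2 * m ∸ 1 → χ≥ G r (2 * m)
  part-i _ k colouring = subst (_≤ k) (*-comm m 2) (clique⇒χ≥ G (combine-map {m} {2} id (first-edge {n′})) clique r k colouring)
    where
    clique : IsClique G (combine-map {m} {2} id (first-edge {n′}))
    clique = Lex-clique (K m) (P n) id first-edge (K-clique m) (P-first-edge-clique n′)

  part-ii : ∀ δ → IsMinDegree G δ → 2 * m ≤ r → r ≤ δ → χ≥ G r (r + 2 + floorDiv (r ∸ 2 * m) (m ∸ 1))
  part-ii δ (_ , δ≤deg) 2m≤r r≤δ k (c , dynamic) =
    floorDiv-bound (suc a) r k 2m≤r (colour-count-bound {d = suc (suc a)} (P n) zero (suc zero) P-zero-neighbour dynamic r≤deg)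
    where
    r≤deg : ∀ (g : Fin m) → r ≤ deg G (combine g (zero {suc n′}))
    r≤deg g = ≤-trans r≤δ (δ≤deg (combine g (zero {suc n′})))

  part-iii : ∀ Δ → IsMaxDegree G Δ → Δ ≤ r → χ≥ G r (m * n)
  part-iii Δ (_ , deg≤Δ) Δ≤r = diameter≤2⇒χ≥ G (Lex-K-diameter≤2 (P n)) r (λ v → ≤-trans (deg≤Δ v) Δ≤r)
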